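{- A map $f \colon X \to Y$ between orthosets is adjointable if and only if $f$ preserves $\parallel$ and $P(f)$ is adjointable. In this case, a map $g \colon Y \to X$ is an adjoint of $f$ if and only if $g$ preserves $\parallel$ and $P(g)$ is an adjoint of $P(f)$.
   Context: An orthoset (with $0$) is a non-empty set $X$ with a binary relation $\perp$ and element $0$ such that: $\perp$ is symmetric; $x\perp x$ iff $x=0$; $0\perp x$ for all $x$. For $x\in X$, $\{x\}^\perp=\{z:z\perp x\}$; $x\parallel y$ (equivalent) iff $\{x\}^\perp=\{y\}^\perp$; $[x]$ denotes the $\parallel$-class of $x$. The irredundant quotient $P(X)=\{[x]:x\in X\}$ is an orthoset with $[x]\perp[y]$ iff $x\perp y$ and zero $[0]=\{0\}$. A map $f$ preserves $\parallel$ if $x\parallel x'$ implies $f(x)\parallel f(x')$; then $P(f)\colon P(X)\to P(Y)$, $[x]\mapsto[f(x)]$. A map $g\colon Y\to X$ is an adjoint of $f\colon X\to Y$ if $f(x)\perp y\iff x\perp g(y)$ for all $x,y$; $f$ is adjointable if it has an adjoint. -}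

module Defs where

open import Level using (Level; _⊔_; suc)
open import Data.Product using (Σ; _,_; proj₁; proj₂)
open import Function.Bundles using (_⇔_; mk⇔; Equivalence)
open import Relation.Binary.PropositionalEquality using (_≡_; refl; subst)
open import Relation.Binary.Structures using (IsEquivalence)

record Orthoset (a ℓ : Level) : Set (suc (a ⊔ ℓ)) where
  infix 4 _⊥_
  field
    Carrier : Set a
    _⊥_     : Carrier → Carrier → Set ℓ
    𝟎       : Carrier
    ⊥-sym   : ∀ {x y} → x ⊥ y → y ⊥ x
    ⊥-self  : ∀ x → (x ⊥ x) ⇔ (x ≡ 𝟎)
    𝟎-⊥     : ∀ x → 𝟎 ⊥ x

-- Orthosets whose carrier is a setoid; used to represent the quotient
-- P(X) = X/∥ (Agda without cubical has no quotient types).  Elements of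
-- the carrier are representatives, _≈_ says "same class".

record SOrthoset (a ℓ e : Level) : Set (suc (a ⊔ ℓ ⊔ e)) where
  infix 4 _⊥_ _≈_
  field
    Carrier : Set a
    _≈_     : Carrier → Carrier → Set e
    isEquiv : IsEquivalence _≈_
    _⊥_     : Carrier → Carrier → Set ℓ
    𝟎       : Carrier
    ⊥-resp  : ∀ {x x' y y'} → x ≈ x' → y ≈ y' → x ⊥ y → x' ⊥ y'
    ⊥-sym   : ∀ {x y} → x ⊥ y → y ⊥ x
    ⊥-self  : ∀ x → (x ⊥ x) ⇔ (x ≈ 𝟎)
    𝟎-⊥     : ∀ x → 𝟎 ⊥ x

-- maps between quotient-orthosets: functions on classes, i.e.
-- ≈-respecting functions on representatives
record SMap {a ℓ e b m f : Level}
            (X : SOrthoset a ℓ e) (Y : SOrthoset b m f)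
            : Set (a ⊔ e ⊔ b ⊔ f) where
  field
    fun  : SOrthoset.Carrier X → SOrthoset.Carrier Y
    cong : ∀ {x x'} → SOrthoset._≈_ X x x' → SOrthoset._≈_ Y (fun x) (fun x')
open SMap public

module _ {a ℓ b m : Level} (X : Orthoset a ℓ) (Y : Orthoset b m) where
  private
    module X = Orthoset X
    module Y = Orthoset Y

  IsAdjoint : (X.Carrier → Y.Carrier) → (Y.Carrier → X.Carrier) → Set (a ⊔ b ⊔ ℓ ⊔ m)
  IsAdjoint f g = ∀ x y → (f x Y.⊥ y) ⇔ (x X.⊥ g y)

  Adjointable : (X.Carrier → Y.Carrier) → Set (a ⊔ b ⊔ ℓ ⊔ m)
  Adjointable f = Σ (Y.Carrier → X.Carrier) λ g → IsAdjoint f g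

module _ {a ℓ e b m f : Level} (X : SOrthoset a ℓ e) (Y : SOrthoset b m f) where
  private
    module X = SOrthoset X
    module Y = SOrthoset Y

  SIsAdjoint : SMap X Y → SMap Y X → Set (a ⊔ b ⊔ ℓ ⊔ m)
  SIsAdjoint F G = ∀ x y → (fun F x Y.⊥ y) ⇔ (x X.⊥ fun G y)

  SAdjointable : SMap X Y → Set (a ⊔ b ⊔ e ⊔ f ⊔ ℓ ⊔ m)
  SAdjointable F = Σ (SMap Y X) λ G → SIsAdjoint F G

module _ {a ℓ : Level} (X : Orthoset a ℓ) where
  open Orthoset X

  -- x ∥ y  iff  {x}^⊥ = {y}^⊥  (equality of subsets, pointwise)
  _∥_ : Carrier → Carrier → Set (a ⊔ ℓ)
  x ∥ y = ∀ z → (z ⊥ x) ⇔ (z ⊥ y)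

  private
    ∥-equiv : IsEquivalence _∥_
    ∥-equiv = record
      { refl  = λ z → mk⇔ (λ p → p) (λ p → p)
      ; sym   = λ p z → mk⇔ (Equivalence.from (p z)) (Equivalence.to (p z))
      ; trans = λ p q z → mk⇔ (λ r → Equivalence.to (q z) (Equivalence.to (p z) r))
                              (λ r → Equivalence.from (p z) (Equivalence.from (q z) r))
      }

    resp : ∀ {x x' y y'} → x ∥ x' → y ∥ y' → x ⊥ y → x' ⊥ y'
    resp {x} {x'} {y} {y'} p q r =
      ⊥-sym (Equivalence.to (p y') (⊥-sym (Equivalence.to (q x) r)))

    self : ∀ x → (x ⊥ x) ⇔ (x ∥ 𝟎)
    self x = mk⇔
      (λ r → subst (λ w → w ∥ 𝟎) (sym' (Equivalence.to (⊥-self x) r))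
                   (IsEquivalence.refl ∥-equiv))
      (λ p → ⊥-sym (Equivalence.from (p x) (⊥-sym (𝟎-⊥ x))))
      where
        sym' : ∀ {u v : Carrier} → u ≡ v → v ≡ u
        sym' refl = refl

  P : SOrthoset a ℓ (a ⊔ ℓ)
  P = record
    { Carrier = Carrier
    ; _≈_     = _∥_
    ; isEquiv = ∥-equiv
    ; _⊥_     = _⊥_
    ; 𝟎       = 𝟎
    ; ⊥-resp  = resp
    ; ⊥-sym   = ⊥-sym
    ; ⊥-self  = self
    ; 𝟎-⊥     = 𝟎-⊥
    }

module _ {a ℓ b m : Level} (X : Orthoset a ℓ) (Y : Orthoset b m) where
  private
    module X = Orthoset X
    module Y = Orthoset Y

  Preserves∥ : (X.Carrier → Y.Carrier) → Set (a ⊔ ℓ ⊔ b ⊔ m)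
  Preserves∥ f = ∀ {x x'} → _∥_ X x x' → _∥_ Y (f x) (f x')

  Pmap : (f : X.Carrier → Y.Carrier) → Preserves∥ f → SMap (P X) (P Y)
  Pmap f p = record { fun = f ; cong = p }

-- Adjoints preserve ∥: if y ∥ y' then w ⊥ g y ⇔ f w ⊥ y ⇔ f w ⊥ y' ⇔ w ⊥ g y',
-- and f is in turn an adjoint of g because ⊥ is symmetric.  Since P(X) carries
-- the orthogonality of X on representatives, an adjunction between ∥-preserving
-- maps is literally the same thing as an adjunction between the induced maps.
module Submission where

open import Defs
open import Data.Product using (Σ; _×_; _,_)
open import Function.Bundles using (_⇔_; mk⇔)
open import Function.Properties.Equivalence using () renaming (sym to ⇔-sym; trans to ⇔-trans)
open import Level using (Level)

⊥-sym-⇔ : {a ℓ : Level} (X : Orthoset a ℓ) {x y : Orthoset.Carrier X} →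
  Orthoset._⊥_ X x y ⇔ Orthoset._⊥_ X y x
⊥-sym-⇔ X = mk⇔ (Orthoset.⊥-sym X) (Orthoset.⊥-sym X)

module _ {a ℓ b m : Level} (X : Orthoset a ℓ) (Y : Orthoset b m)
         {f : Orthoset.Carrier X → Orthoset.Carrier Y} where

  IsAdjoint-flip : {g : Orthoset.Carrier Y → Orthoset.Carrier X} →
    IsAdjoint X Y f g → IsAdjoint Y X g f
  IsAdjoint-flip adj y x = ⇔-trans (⊥-sym-⇔ X) (⇔-trans (⇔-sym (adj x y)) (⊥-sym-⇔ Y))

  adjoint-preserves∥ : {g : Orthoset.Carrier Y → Orthoset.Carrier X} →
    IsAdjoint X Y f g → Preserves∥ Y X g
  adjoint-preserves∥ adj {y} {y'} y∥y' w =
    ⇔-trans (⇔-sym (adj w y)) (⇔-trans (y∥y' (f w)) (adj w y'))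

module _ {a ℓ b m : Level} (X : Orthoset a ℓ) (Y : Orthoset b m)
         {f : Orthoset.Carrier X → Orthoset.Carrier Y} where

  adjointable-preserves∥ : Adjointable X Y f → Preserves∥ X Y f
  adjointable-preserves∥ (g , adj) = adjoint-preserves∥ Y X (IsAdjoint-flip X Y adj)

  IsAdjoint⇔preserves∥×P-adjoint : (p : Preserves∥ X Y f) (g : Orthoset.Carrier Y → Orthoset.Carrier X) →
    IsAdjoint X Y f g ⇔ Σ (Preserves∥ Y X g) (λ q → SIsAdjoint (P X) (P Y) (Pmap X Y f p) (Pmap Y X g q))
  IsAdjoint⇔preserves∥×P-adjoint p g = mk⇔
    (λ adj → (λ {y y'} → adjoint-preserves∥ X Y adj {y} {y'}) , adj)
    (λ (_ , adj) → adj)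

  Adjointable⇔preserves∥×P-adjointable :
    Adjointable X Y f ⇔ Σ (Preserves∥ X Y f) (λ p → SAdjointable (P X) (P Y) (Pmap X Y f p))
  Adjointable⇔preserves∥×P-adjointable = mk⇔
    (λ f-adj@(g , adj) → adjointable-preserves∥ f-adj
                       , Pmap Y X g (λ {y y'} → adjoint-preserves∥ X Y adj {y} {y'})
                       , adj)
    (λ (_ , G , adj) → fun G , adj)

proposition3p3 : {a ℓ b m : Level} (X : Orthoset a ℓ) (Y : Orthoset b m)
    (f : Orthoset.Carrier X → Orthoset.Carrier Y) →
    (Adjointable X Y f ⇔ Σ (Preserves∥ X Y f) (λ p → SAdjointable (P X) (P Y) (Pmap X Y f p)))
    × (Adjointable X Y f → (p : Preserves∥ X Y f) → (g : Orthoset.Carrier Y → Orthoset.Carrier X) →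
    (IsAdjoint X Y f g ⇔ Σ (Preserves∥ Y X g) (λ q → SIsAdjoint (P X) (P Y) (Pmap X Y f p) (Pmap Y X g q))))
proposition3p3 X Y f =
  Adjointable⇔preserves∥×P-adjointable X Y , λ _ → IsAdjoint⇔preserves∥×P-adjoint X Y
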